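{- Let $n,m,k,\ell,c$ be positive integers with $k+\ell<m=n$, and consider the equation $x^n+y^m=c\,x^k y^\ell$ in positive integers $x,y$. (i) A pair $(x,y)$ of positive integers is a solution if and only if there exist positive integers $d,x_1,y_1,r$ with $\gcd(x_1,y_1)=1$ such that $x=d\,x_1$, $y=d\,y_1$ (so $d=\gcd(x,y)$), $d^{n-(k+\ell)}=x_1^k y_1^\ell\, r$, and $r\,(x_1^n+y_1^n)=c$. (ii) If $c=2$, the equation has the unique solution $(x,y)=(1,1)$. (iii) If $c=1$, the equation has no positive integer solutions. (iv) If $c=4$ and $n=k+\ell+1$, the equation has the unique solution $(x,y)=(2,2)$; if $c=4$ and $n-(k+\ell)\ge 2$, the equation has no solution. (v) If $c\ge 3$ is a prime and $n$ is odd, the equation has no solutions.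
   Context: A solution means an ordered pair $(x,y)$ of positive integers satisfying the equation. -}

module Defs where

open import Data.Nat using (ℕ; _+_; _*_; _^_; _<_)
open import Data.Product using (_×_)
open import Relation.Binary.PropositionalEquality using (_≡_)

Solution : ℕ → ℕ → ℕ → ℕ → ℕ → ℕ → ℕ → Set
Solution n m k ℓ c x y = 0 < x × 0 < y × x ^ n + y ^ m ≡ c * (x ^ k) * (y ^ ℓ)

-- Write x = d x₁ and y = d y₁ with d = gcd x y. Dividing the equation by d^(k+ℓ) leaves
-- d^e (x₁^n + y₁^n) = c x₁^k y₁^ℓ with e = n - (k + ℓ); as x₁^k y₁^ℓ is coprime to
-- x₁^n + y₁^n it divides d^e, and the cofactor r satisfies r (x₁^n + y₁^n) = c. Hence
-- x₁^n + y₁^n ≤ c, so for c ≤ 4 (and n ≥ 2) we get x₁ = y₁ = 1 and the solutions are the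
-- diagonal pairs (d, d) with 2 d^e = c. For a prime c and odd n, x₁ + y₁ divides
-- x₁^n + y₁^n, which divides c; both are at least 2, so both equal c, forcing x₁ = y₁ = 1
-- and c = 2.
module Submission where

open import Defs
open import Data.Nat using (ℕ; zero; suc; _+_; _*_; _^_; _<_; _≤_; _∸_; NonZero; >-nonZero; ≢-nonZero; s≤s; z≤n; z<s)
open import Data.Nat.Properties
open import Data.Nat.Divisibility using (_∣_; divides; ∣-refl; ∣-trans; ∣m+n∣m⇒∣n; ∣n⇒∣m*n; m∣m*n; ∣1⇒≡1)
open import Data.Nat.Coprimality using (Coprime; coprime-divisor; coprime-/gcd; coprime⇒gcd≡1) renaming (sym to coprime-sym)
open import Data.Nat.GCD using (gcd; gcd[m,n]∣m; gcd[m,n]∣n; gcd[m,n]≢0; gcd-zeroˡ)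
open import Data.Nat.DivMod using (_/_; _%_; m*[n/m]≡n; m≡m%n+[m/n]*n)
open import Data.Nat.Primality using (Prime; prime⇒irreducible)
open import Data.Nat.Tactic.RingSolver using (solve-∀)
open import Data.Product using (_×_; ∃-syntax; _,_)
open import Data.Sum using (inj₁; inj₂)
open import Function.Bundles using (_⇔_; mk⇔; Equivalence)
open import Function.Construct.Composition using (_⇔-∘_)
open import Relation.Binary.PropositionalEquality
open import Relation.Nullary using (¬_; contradiction)

open ≡-Reasoning

^-positive : ∀ {a} n → 0 < a → 0 < a ^ n
^-positive {a} n 0<a = m^n>0 a {{>-nonZero 0<a}} n

*-positiveʳ : ∀ m n → 0 < m * n → 0 < n
*-positiveʳ m zero 0<m*0 = contradiction (*-zeroʳ m) (>⇒≢ 0<m*0)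
*-positiveʳ m (suc n) _ = z<s

^-distribʳ-* : ∀ m n o → (m * n) ^ o ≡ m ^ o * n ^ o
^-distribʳ-* m n zero = refl
^-distribʳ-* m n (suc o) = begin
  m * n * (m * n) ^ o      ≡⟨ cong (m * n *_) (^-distribʳ-* m n o) ⟩
  m * n * (m ^ o * n ^ o)  ≡⟨ [m*n]*[o*p]≡[m*o]*[n*p] m n (m ^ o) (n ^ o) ⟩
  m ^ suc o * n ^ suc o    ∎

4≤^ : ∀ {a} n → 1 < a → 2 ≤ n → 4 ≤ a ^ n
4≤^ {a@(suc _)} n 1<a 2≤n = ≤-trans (^-monoˡ-≤ 2 1<a) (^-monoʳ-≤ a 2≤n)

^+^≤4⇒≡1 : ∀ n {a b} → 2 ≤ n → 0 < a → 0 < b → a ^ n + b ^ n ≤ 4 → a ≡ 1 × b ≡ 1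
^+^≤4⇒≡1 n {1} {1} _ _ _ _ = refl , refl
^+^≤4⇒≡1 n {suc (suc _)} {b} 2≤n _ 0<b ≤4 =
  contradiction ≤4 (<⇒≱ (+-mono-≤ (4≤^ n (s≤s (s≤s z≤n)) 2≤n) (^-positive n 0<b)))
^+^≤4⇒≡1 n {1} {suc (suc _)} 2≤n 0<a _ ≤4 =
  contradiction ≤4 (<⇒≱ (+-mono-≤ (^-positive n 0<a) (4≤^ n (s≤s (s≤s z≤n)) 2≤n)))

^≢2 : ∀ {x} n → 0 < x → 2 ≤ n → x ^ n ≢ 2
^≢2 {1} n _ _ 1ⁿ≡2 = contradiction (trans (sym (^-zeroˡ n)) 1ⁿ≡2) λ ()
^≢2 {suc (suc _)} n _ 2≤n xⁿ≡2 = contradiction (subst (4 ≤_) xⁿ≡2 (4≤^ n (s≤s (s≤s z≤n)) 2≤n)) λ { (s≤s (s≤s ())) }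

m≤m^n : ∀ {m n} → 0 < m → 0 < n → m ≤ m ^ n
m≤m^n {m@(suc _)} {n} _ 0<n = subst (_≤ m ^ n) (^-identityʳ m) (^-monoʳ-≤ m 0<n)

m<m^n : ∀ {m n} → 1 < m → 1 < n → m < m ^ n
m<m^n {m} {n} 1<m 1<n = subst (_< m ^ n) (^-identityʳ m) (^-monoʳ-< m 1<m 1<n)

^+^≡+⇒≡1 : ∀ n {a b} → 2 ≤ n → 0 < a → 0 < b → a ^ n + b ^ n ≡ a + b → a ≡ 1 × b ≡ 1
^+^≡+⇒≡1 n {1} {1} _ _ _ _ = refl , refl
^+^≡+⇒≡1 n {suc (suc _)} 2≤n _ 0<b eq =
  contradiction (sym eq) (<⇒≢ (+-mono-<-≤ (m<m^n (s≤s (s≤s z≤n)) 2≤n) (m≤m^n 0<b (≤-trans z<s 2≤n))))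
^+^≡+⇒≡1 n {1} {suc (suc _)} 2≤n 0<a _ eq =
  contradiction (sym eq) (<⇒≢ (+-mono-≤-< (m≤m^n 0<a (≤-trans z<s 2≤n)) (m<m^n (s≤s (s≤s z≤n)) 2≤n)))

coprime-*ʳ : ∀ {m n o} → Coprime m n → Coprime m o → Coprime m (n * o)
coprime-*ʳ {m} {n} cop-mn cop-mo (d∣m , d∣no) = cop-mo (d∣m , coprime-divisor (cop-dn d∣m) d∣no)
  where
  cop-dn : ∀ {d} → d ∣ m → Coprime d n
  cop-dn d∣m (e∣d , e∣n) = cop-mn (∣-trans e∣d d∣m , e∣n)

coprime-^ʳ : ∀ {m n} i → Coprime m n → Coprime m (n ^ i)
coprime-^ʳ zero _ (_ , d∣1) = ∣1⇒≡1 d∣1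
coprime-^ʳ (suc i) cop = coprime-*ʳ cop (coprime-^ʳ i cop)

coprime-^+^ : ∀ {a b} n → .{{NonZero n}} → Coprime a b → Coprime a (a ^ n + b ^ n)
coprime-^+^ {a} {b} n@(suc n-1) cop (d∣a , d∣sum) =
  coprime-^ʳ n cop (d∣a , ∣m+n∣m⇒∣n d∣sum (∣-trans d∣a (m∣m*n (a ^ n-1))))

coprime-^*^-^+^ : ∀ {a b} n k ℓ → .{{NonZero n}} → Coprime a b →
                  Coprime (a ^ k * b ^ ℓ) (a ^ n + b ^ n)
coprime-^*^-^+^ {a} {b} n k ℓ cop = coprime-sym (coprime-*ʳ
  (coprime-^ʳ k (coprime-sym (coprime-^+^ n cop)))
  (coprime-^ʳ ℓ (coprime-sym (subst (Coprime b) (+-comm (b ^ n) (a ^ n)) (coprime-^+^ n (coprime-sym cop))))))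

coprime-cofactor : ∀ {a s e c} .{{_ : NonZero a}} → Coprime a s → e * s ≡ c * a →
                   ∃[ r ] (e ≡ a * r × r * s ≡ c)
coprime-cofactor {a} {s} {e} {c} cop eq with coprime-divisor cop (divides c (trans (*-comm s e) eq))
... | divides r e≡r*a = r , trans e≡r*a (*-comm r a) , *-cancelˡ-≡ (r * s) c a (begin
  a * (r * s)  ≡⟨ *-assoc a r s ⟨
  a * r * s    ≡⟨ cong (_* s) (trans (*-comm a r) (sym e≡r*a)) ⟩
  e * s        ≡⟨ eq ⟩
  c * a        ≡⟨ *-comm c a ⟩
  a * c        ∎)

^-split : ∀ d {n s} → s ≤ n → d ^ n ≡ d ^ s * d ^ (n ∸ s)
^-split d {n} {s} s≤n = trans (cong (d ^_) (sym (m+[n∸m]≡n s≤n))) (^-distribˡ-+-* d s (n ∸ s))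

scaled-equation⇔ : ∀ n k ℓ c d a b → .{{NonZero d}} → k + ℓ ≤ n →
  (d * a) ^ n + (d * b) ^ n ≡ c * (d * a) ^ k * (d * b) ^ ℓ ⇔
  d ^ (n ∸ (k + ℓ)) * (a ^ n + b ^ n) ≡ c * (a ^ k * b ^ ℓ)
scaled-equation⇔ n k ℓ c d a b k+ℓ≤n = mk⇔
  (λ eq → *-cancelˡ-≡ _ _ (d ^ (k + ℓ)) {{m^n≢0 d (k + ℓ)}} (trans (sym lhs) (trans eq rhs)))
  (λ eq → trans lhs (trans (cong (d ^ (k + ℓ) *_) eq) (sym rhs)))
  where
  lhs : (d * a) ^ n + (d * b) ^ n ≡ d ^ (k + ℓ) * (d ^ (n ∸ (k + ℓ)) * (a ^ n + b ^ n))
  lhs = begin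
    (d * a) ^ n + (d * b) ^ n                           ≡⟨ cong₂ _+_ (^-distribʳ-* d a n) (^-distribʳ-* d b n) ⟩
    d ^ n * a ^ n + d ^ n * b ^ n                       ≡⟨ *-distribˡ-+ (d ^ n) (a ^ n) (b ^ n) ⟨
    d ^ n * (a ^ n + b ^ n)                             ≡⟨ cong (_* (a ^ n + b ^ n)) (^-split d k+ℓ≤n) ⟩
    d ^ (k + ℓ) * d ^ (n ∸ (k + ℓ)) * (a ^ n + b ^ n)   ≡⟨ *-assoc (d ^ (k + ℓ)) _ _ ⟩
    d ^ (k + ℓ) * (d ^ (n ∸ (k + ℓ)) * (a ^ n + b ^ n)) ∎
  rearrange : ∀ c D E A B → c * (D * A) * (E * B) ≡ D * E * (c * (A * B))
  rearrange = solve-∀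
  rhs : c * (d * a) ^ k * (d * b) ^ ℓ ≡ d ^ (k + ℓ) * (c * (a ^ k * b ^ ℓ))
  rhs = begin
    c * (d * a) ^ k * (d * b) ^ ℓ                   ≡⟨ cong₂ (λ u v → c * u * v) (^-distribʳ-* d a k) (^-distribʳ-* d b ℓ) ⟩
    c * (d ^ k * a ^ k) * (d ^ ℓ * b ^ ℓ)           ≡⟨ rearrange c (d ^ k) (d ^ ℓ) (a ^ k) (b ^ ℓ) ⟩
    d ^ k * d ^ ℓ * (c * (a ^ k * b ^ ℓ))           ≡⟨ cong (_* (c * (a ^ k * b ^ ℓ))) (^-distribˡ-+-* d k ℓ) ⟨
    d ^ (k + ℓ) * (c * (a ^ k * b ^ ℓ))             ∎

Parametrisation : ℕ → ℕ → ℕ → ℕ → ℕ → ℕ → Set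
Parametrisation n k ℓ c x y = ∃[ d ] ∃[ x₁ ] ∃[ y₁ ] ∃[ r ]
  (0 < d × 0 < x₁ × 0 < y₁ × 0 < r × gcd x₁ y₁ ≡ 1 ×
   x ≡ d * x₁ × y ≡ d * y₁ ×
   d ^ (n ∸ (k + ℓ)) ≡ x₁ ^ k * y₁ ^ ℓ * r ×
   r * (x₁ ^ n + y₁ ^ n) ≡ c)

gcd-factorisation : ∀ {x y} → 0 < x →
  ∃[ d ] ∃[ x₁ ] ∃[ y₁ ] (0 < d × Coprime x₁ y₁ × x ≡ d * x₁ × y ≡ d * y₁)
gcd-factorisation {x} {y} 0<x =
  gcd x y , x / gcd x y , y / gcd x y , n≢0⇒n>0 gcd≢0 , coprime-/gcd x y ,
  sym (m*[n/m]≡n (gcd[m,n]∣m x y)) , sym (m*[n/m]≡n (gcd[m,n]∣n x y))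
  where
  gcd≢0 = gcd[m,n]≢0 x y (inj₁ (n>0⇒n≢0 0<x))
  instance
    _ : NonZero (gcd x y)
    _ = ≢-nonZero gcd≢0

scaled-solution⇒parametrisation : ∀ n k ℓ c {d a b} → k + ℓ < n → 0 < d → 0 < a → 0 < b →
  Coprime a b → (d * a) ^ n + (d * b) ^ n ≡ c * (d * a) ^ k * (d * b) ^ ℓ →
  Parametrisation n k ℓ c (d * a) (d * b)
scaled-solution⇒parametrisation n k ℓ c {d} {a} {b} k+ℓ<n 0<d 0<a 0<b cop eq =
  let r , dᵉ≡Ar , rS≡c = coprime-cofactor {{>-nonZero 0<A}} (coprime-^*^-^+^ n k ℓ cop) reduced
  in d , a , b , r , 0<d , 0<a , 0<b ,
     *-positiveʳ (a ^ k * b ^ ℓ) r (subst (0 <_) dᵉ≡Ar (^-positive (n ∸ (k + ℓ)) 0<d)) ,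
     coprime⇒gcd≡1 cop , refl , refl , dᵉ≡Ar , rS≡c
  where
  instance
    _ : NonZero d
    _ = >-nonZero 0<d
    _ : NonZero n
    _ = >-nonZero (≤-trans z<s k+ℓ<n)
  0<A : 0 < a ^ k * b ^ ℓ
  0<A = *-mono-≤ (^-positive k 0<a) (^-positive ℓ 0<b)
  reduced : d ^ (n ∸ (k + ℓ)) * (a ^ n + b ^ n) ≡ c * (a ^ k * b ^ ℓ)
  reduced = Equivalence.to (scaled-equation⇔ n k ℓ c d a b (<⇒≤ k+ℓ<n)) eq

solution⇒parametrisation : ∀ n k ℓ c x y → k + ℓ < n → Solution n n k ℓ c x y → Parametrisation n k ℓ c x y
solution⇒parametrisation n k ℓ c x y k+ℓ<n (0<x , 0<y , eq) with gcd-factorisation {y = y} 0<x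
... | d , x₁ , y₁ , 0<d , cop , refl , refl =
  scaled-solution⇒parametrisation n k ℓ c k+ℓ<n 0<d (*-positiveʳ d x₁ 0<x) (*-positiveʳ d y₁ 0<y) cop eq

parametrisation⇒solution : ∀ n k ℓ c x y → k + ℓ ≤ n → Parametrisation n k ℓ c x y → Solution n n k ℓ c x y
parametrisation⇒solution n k ℓ c x y k+ℓ≤n (d , a , b , r , 0<d , 0<a , 0<b , _ , _ , refl , refl , dᵉ≡Ar , refl) =
  *-mono-≤ 0<d 0<a , *-mono-≤ 0<d 0<b ,
  Equivalence.from (scaled-equation⇔ n k ℓ c d a b {{>-nonZero 0<d}} k+ℓ≤n) (begin
    d ^ (n ∸ (k + ℓ)) * S  ≡⟨ cong (_* S) dᵉ≡Ar ⟩
    A * r * S              ≡⟨ *-assoc A r S ⟩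
    A * (r * S)            ≡⟨ *-comm A (r * S) ⟩
    r * S * A              ∎)
  where
  S = a ^ n + b ^ n
  A = a ^ k * b ^ ℓ

parametrisation⇒diagonal : ∀ n k ℓ c x y → 2 ≤ n → c ≤ 4 → Parametrisation n k ℓ c x y →
  0 < x × x ≡ y × x ^ (n ∸ (k + ℓ)) * 2 ≡ c
parametrisation⇒diagonal n k ℓ c _ _ 2≤n c≤4 (d , a , b , r , 0<d , 0<a , 0<b , 0<r , _ , refl , refl , dᵉ≡Ar , rS≡c)
  with ^+^≤4⇒≡1 n 2≤n 0<a 0<b (≤-trans (m≤n*m (a ^ n + b ^ n) r {{>-nonZero 0<r}}) (≤-trans (≤-reflexive rS≡c) c≤4))
... | refl , refl = *-mono-≤ 0<d z<s , refl , (begin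
  (d * 1) ^ e * 2        ≡⟨ cong (λ u → u ^ e * 2) (*-identityʳ d) ⟩
  d ^ e * 2              ≡⟨ cong (_* 2) dᵉ≡Ar ⟩
  1 ^ k * 1 ^ ℓ * r * 2  ≡⟨ cong₂ (λ u v → u * v * r * 2) (^-zeroˡ k) (^-zeroˡ ℓ) ⟩
  1 * r * 2              ≡⟨ cong (_* 2) (*-identityˡ r) ⟩
  r * 2                  ≡⟨ cong (λ u → r * (u + u)) (^-zeroˡ n) ⟨
  r * (1 ^ n + 1 ^ n)    ≡⟨ rS≡c ⟩
  c                      ∎)
  where e = n ∸ (k + ℓ)

diagonal⇒parametrisation : ∀ n k ℓ c x → 0 < x → x ^ (n ∸ (k + ℓ)) * 2 ≡ c → Parametrisation n k ℓ c x x
diagonal⇒parametrisation n k ℓ c x 0<x xᵉ2≡c =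
  x , 1 , 1 , x ^ e , 0<x , z<s , z<s , ^-positive e 0<x , gcd-zeroˡ 1 ,
  sym (*-identityʳ x) , sym (*-identityʳ x) ,
  sym (trans (cong₂ (λ u v → u * v * x ^ e) (^-zeroˡ k) (^-zeroˡ ℓ)) (*-identityˡ (x ^ e))) ,
  trans (cong (λ u → x ^ e * (u + u)) (^-zeroˡ n)) xᵉ2≡c
  where e = n ∸ (k + ℓ)

^+^-recurrence : ∀ a b m →
  (a + b) * (a ^ suc m + b ^ suc m) ≡ a * b * (a ^ m + b ^ m) + (a ^ suc (suc m) + b ^ suc (suc m))
^+^-recurrence a b m = identity a b (a ^ m) (b ^ m)
  where
  identity : ∀ a b t u → (a + b) * (a * t + b * u) ≡ a * b * (t + u) + (a * (a * t) + b * (b * u))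
  identity = solve-∀

+∣^+^-odd : ∀ a b j → a + b ∣ a ^ suc (j * 2) + b ^ suc (j * 2)
+∣^+^-odd a b zero = subst (a + b ∣_) (sym (cong₂ _+_ (*-identityʳ a) (*-identityʳ b))) ∣-refl
+∣^+^-odd a b (suc j) = ∣m+n∣m⇒∣n
  (subst (a + b ∣_) (^+^-recurrence a b (suc (j * 2))) (m∣m*n _))
  (∣n⇒∣m*n (a * b) (+∣^+^-odd a b j))

+∣^+^ : ∀ a b n → n % 2 ≡ 1 → a + b ∣ a ^ n + b ^ n
+∣^+^ a b n odd = subst (λ m → a + b ∣ a ^ m + b ^ m) (sym n≡1+[n/2]*2) (+∣^+^-odd a b (n / 2))
  where
  n≡1+[n/2]*2 : n ≡ suc (n / 2 * 2)
  n≡1+[n/2]*2 = trans (m≡m%n+[m/n]*n n 2) (cong (_+ n / 2 * 2) odd)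

prime-divisor : ∀ {p d} → Prime p → 1 < d → d ∣ p → d ≡ p
prime-divisor p-prime 1<d d∣p with prime⇒irreducible p-prime d∣p
... | inj₁ refl = contradiction 1<d (<-irrefl refl)
... | inj₂ d≡p = d≡p

parametrisation-prime-odd : ∀ n k ℓ c x y → 2 ≤ n → 3 ≤ c → Prime c → n % 2 ≡ 1 →
  ¬ Parametrisation n k ℓ c x y
parametrisation-prime-odd n k ℓ c x y 2≤n 3≤c c-prime odd (_ , a , b , r , _ , 0<a , 0<b , _ , _ , _ , _ , _ , rS≡c) =
  contradiction (subst (3 ≤_) (sym 2≡c) 3≤c) λ { (s≤s (s≤s ())) }
  where
  S≡c : a ^ n + b ^ n ≡ c
  S≡c = prime-divisor c-prime (+-mono-≤ (^-positive n 0<a) (^-positive n 0<b)) (divides r (sym rS≡c))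
  a+b≡c : a + b ≡ c
  a+b≡c = prime-divisor c-prime (+-mono-≤ 0<a 0<b) (subst (a + b ∣_) S≡c (+∣^+^ a b n odd))
  2≡c : 2 ≡ c
  2≡c with ^+^≡+⇒≡1 n 2≤n 0<a 0<b (trans S≡c (sym a+b≡c))
  ... | refl , refl = a+b≡c

module EqualExponents (n k ℓ : ℕ) (0<k : 0 < k) (0<ℓ : 0 < ℓ) (k+ℓ<n : k + ℓ < n) where

  private
    e : ℕ
    e = n ∸ (k + ℓ)
    2≤n : 2 ≤ n
    2≤n = ≤-trans (+-mono-≤ 0<k 0<ℓ) (<⇒≤ k+ℓ<n)

  solution⇔parametrisation : ∀ c x y → Solution n n k ℓ c x y ⇔ Parametrisation n k ℓ c x y
  solution⇔parametrisation c x y =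
    mk⇔ (solution⇒parametrisation n k ℓ c x y k+ℓ<n) (parametrisation⇒solution n k ℓ c x y (<⇒≤ k+ℓ<n))

  solution⇔diagonal : ∀ c x y → c ≤ 4 → Solution n n k ℓ c x y ⇔ (0 < x × x ≡ y × x ^ e * 2 ≡ c)
  solution⇔diagonal c x y c≤4 = mk⇔
    (λ sol → parametrisation⇒diagonal n k ℓ c x y 2≤n c≤4 (solution⇒parametrisation n k ℓ c x y k+ℓ<n sol))
    (λ { (0<x , refl , eq) → parametrisation⇒solution n k ℓ c x x (<⇒≤ k+ℓ<n) (diagonal⇒parametrisation n k ℓ c x 0<x eq) })

  no-solution-1 : ∀ x y → ¬ Solution n n k ℓ 1 x y
  no-solution-1 x y sol =
    let _ , _ , xᵉ2≡1 = Equivalence.to (solution⇔diagonal 1 x y (s≤s z≤n)) sol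
    in even≢odd (x ^ e) 0 (trans (*-comm 2 (x ^ e)) xᵉ2≡1)

  solution-2⇔ : ∀ x y → Solution n n k ℓ 2 x y ⇔ (x ≡ 1 × y ≡ 1)
  solution-2⇔ x y = mk⇔ diagonal⇒1 1⇒diagonal ⇔-∘ solution⇔diagonal 2 x y (s≤s (s≤s z≤n))
    where
    diagonal⇒1 : ∀ {x y} → 0 < x × x ≡ y × x ^ e * 2 ≡ 2 → x ≡ 1 × y ≡ 1
    diagonal⇒1 {x} (_ , refl , xᵉ2≡2) with m^n≡1⇒n≡0∨m≡1 x e (*-cancelʳ-≡ _ 1 2 xᵉ2≡2)
    ... | inj₁ e≡0 = contradiction e≡0 (n>0⇒n≢0 (m<n⇒0<n∸m k+ℓ<n))
    ... | inj₂ x≡1 = x≡1 , x≡1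
    1⇒diagonal : ∀ {x y} → x ≡ 1 × y ≡ 1 → 0 < x × x ≡ y × x ^ e * 2 ≡ 2
    1⇒diagonal (refl , refl) = z<s , refl , cong (_* 2) (^-zeroˡ e)

  solution-4⇔ : n ≡ k + ℓ + 1 → ∀ x y → Solution n n k ℓ 4 x y ⇔ (x ≡ 2 × y ≡ 2)
  solution-4⇔ n≡k+ℓ+1 x y = mk⇔ diagonal⇒2 2⇒diagonal ⇔-∘ solution⇔diagonal 4 x y ≤-refl
    where
    e≡1 : e ≡ 1
    e≡1 = trans (cong (_∸ (k + ℓ)) n≡k+ℓ+1) (m+n∸m≡n (k + ℓ) 1)
    diagonal⇒2 : ∀ {x y} → 0 < x × x ≡ y × x ^ e * 2 ≡ 4 → x ≡ 2 × y ≡ 2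
    diagonal⇒2 {x} (_ , refl , xᵉ2≡4) =
      let x≡2 = trans (sym (^-identityʳ x)) (subst (λ i → x ^ i ≡ 2) e≡1 (*-cancelʳ-≡ _ 2 2 xᵉ2≡4))
      in x≡2 , x≡2
    2⇒diagonal : ∀ {x y} → x ≡ 2 × y ≡ 2 → 0 < x × x ≡ y × x ^ e * 2 ≡ 4
    2⇒diagonal (refl , refl) = z<s , refl , cong (λ i → 2 ^ i * 2) e≡1

  no-solution-4 : 2 ≤ e → ∀ x y → ¬ Solution n n k ℓ 4 x y
  no-solution-4 2≤e x y sol =
    let 0<x , _ , xᵉ2≡4 = Equivalence.to (solution⇔diagonal 4 x y ≤-refl) sol
    in ^≢2 e 0<x 2≤e (*-cancelʳ-≡ _ 2 2 xᵉ2≡4)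

  no-solution-prime-odd : ∀ c → 3 ≤ c → Prime c → n % 2 ≡ 1 → ∀ x y → ¬ Solution n n k ℓ c x y
  no-solution-prime-odd c 3≤c c-prime odd x y sol =
    parametrisation-prime-odd n k ℓ c x y 2≤n 3≤c c-prime odd (solution⇒parametrisation n k ℓ c x y k+ℓ<n sol)

theorem8 : (n m k ℓ c : ℕ) → 0 < n → 0 < m → 0 < k → 0 < ℓ → 0 < c →
  k + ℓ < m → m ≡ n →
  ((x y : ℕ) → Solution n m k ℓ c x y ⇔
      (∃[ d ] ∃[ x₁ ] ∃[ y₁ ] ∃[ r ]
        (0 < d × 0 < x₁ × 0 < y₁ × 0 < r × gcd x₁ y₁ ≡ 1 ×
         x ≡ d * x₁ × y ≡ d * y₁ ×
         d ^ (n ∸ (k + ℓ)) ≡ x₁ ^ k * y₁ ^ ℓ * r ×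
         r * (x₁ ^ n + y₁ ^ n) ≡ c)))
  × (c ≡ 2 → (x y : ℕ) → Solution n m k ℓ c x y ⇔ (x ≡ 1 × y ≡ 1))
  × (c ≡ 1 → (x y : ℕ) → ¬ Solution n m k ℓ c x y)
  × (c ≡ 4 → n ≡ k + ℓ + 1 → (x y : ℕ) → Solution n m k ℓ c x y ⇔ (x ≡ 2 × y ≡ 2))
  × (c ≡ 4 → 2 ≤ n ∸ (k + ℓ) → (x y : ℕ) → ¬ Solution n m k ℓ c x y)
  × (3 ≤ c → Prime c → n % 2 ≡ 1 → (x y : ℕ) → ¬ Solution n m k ℓ c x y)
theorem8 n _ k ℓ c _ _ 0<k 0<ℓ _ k+ℓ<n refl =
  solution⇔parametrisation c ,
  (λ { refl → solution-2⇔ }) ,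
  (λ { refl → no-solution-1 }) ,
  (λ { refl → solution-4⇔ }) ,
  (λ { refl → no-solution-4 }) ,
  no-solution-prime-odd c
  where open EqualExponents n k ℓ 0<k 0<ℓ k+ℓ<n
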